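{- For every WMST-instance $(G,\hat w,w)$ and every arrival order of the true weights, the algorithm FtP satisfies $\mathrm{FtP}(\hat w,w)\le (1+2\varepsilon)\,\mathrm{Opt}(w)$, where $\varepsilon=\eta/\mathrm{Opt}(w)$; i.e., $\mathrm{cr}_{\mathrm{FtP}}(\varepsilon)\le 1+2\varepsilon$.
   Context: WMST problem with predictions: a WMST-instance is a triple $(G,\hat w,w)$ where $G=(V,E)$ is a finite simple connected undirected graph with $n=|V|$ vertices and $m=|E|$ edges, and $\hat w,w\colon E\to\mathbb{R}^+$ give predicted and true edge weights. An online algorithm initially knows $G$ and $\hat w$; then the true weights arrive one at a time as pairs $(w(e),e)$, each edge once, and upon arrival the algorithm irrevocably accepts or rejects $e$; the accepted edges must form a spanning tree, whose cost is its total true weight. $\mathrm{Opt}(w)$ is the minimum true weight of a spanning tree of $G$. Error: with $p_e=|w(e)-\hat w(e)|$, $\eta$ is the sum of the $n-1$ largest values among $\{p_e\}_{e\in E}$, and $\varepsilon=\eta/\mathrm{Opt}(w)$. Algorithm FtP (Follow-the-Predictions): compute a minimum spanning tree $T$ of $G$ with respect to $\hat w$ before any true weight arrives; upon arrival of $(w(e),e)$, accept $e$ iff $e\in T$. $\mathrm{FtP}(\hat w,w)$ denotes the true weight of $T$.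
   Formalization: The predicted and true edge weights are positive rationals rather than elements of ℝ⁺. -}

module Defs where

open import Data.Nat using (ℕ; _∸_)
open import Data.Fin using (Fin)
open import Data.Fin.Subset using (Subset; ⊤)
open import Data.Bool using (Bool; true; if_then_else_)
import Data.Bool as Bool
open import Data.Vec using (lookup)
open import Data.List using (List; []; _∷_; map; foldr; take; reverse; filter; allFin)
open import Data.List.Relation.Unary.Unique.Propositional using (Unique)
open import Data.Product using (_×_; _,_; ∃; ∃-syntax; Σ-syntax; proj₁; proj₂)
open import Data.Sum using (_⊎_)
open import Relation.Nullary using (¬_)
open import Relation.Binary.PropositionalEquality using (_≡_; _≢_)
open import Data.Rational using (ℚ; 0ℚ; _+_; _-_; ∣_∣; _≤_; Positive)
open import Data.Rational.Properties using (≤-decTotalOrder)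
import Data.List.Sort

record Graph : Set where
  field
    n    : ℕ
    m    : ℕ
    ends : Fin m → Fin n × Fin n

module _ (G : Graph) where
  open Graph G

  Joins : Fin m → Fin n → Fin n → Set
  Joins e u v = ends e ≡ (u , v) ⊎ ends e ≡ (v , u)

  Simple : Set
  Simple = (∀ e → proj₁ (ends e) ≢ proj₂ (ends e))
         × (∀ e f → Joins f (proj₁ (ends e)) (proj₂ (ends e)) → e ≡ f)

  data Walk (S : Subset m) : Fin n → Fin n → List (Fin m) → Set where
    nil  : ∀ {u} → Walk S u u []
    step : ∀ {u v w e es} → lookup S e ≡ true → Joins e u v → Walk S v w es → Walk S u w (e ∷ es)

  ConnectedSub : Subset m → Set
  ConnectedSub S = ∀ u v → ∃[ es ] Walk S u v es

  HasCycle : Subset m → Set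
  HasCycle S = ∃[ v ] ∃[ es ] (Walk S v v es × es ≢ [] × Unique es)

  SpanningTree : Subset m → Set
  SpanningTree S = ConnectedSub S × ¬ HasCycle S

  Connected : Set
  Connected = ConnectedSub ⊤

  sumℚ : List ℚ → ℚ
  sumℚ = foldr _+_ 0ℚ

  cost : (Fin m → ℚ) → Subset m → ℚ
  cost c S = sumℚ (map (λ e → if lookup S e then c e else 0ℚ) (allFin m))

  IsMST : (Fin m → ℚ) → Subset m → Set
  IsMST c T = SpanningTree T × (∀ S → SpanningTree S → cost c T ≤ cost c S)

  IsOpt : (Fin m → ℚ) → ℚ → Set
  IsOpt c opt = (Σ[ T ∈ Subset m ] (SpanningTree T × cost c T ≡ opt))
              × (∀ S → SpanningTree S → opt ≤ cost c S)

  open Data.List.Sort ≤-decTotalOrder using (sort)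

  η : (ŵ w : Fin m → ℚ) → ℚ
  η ŵ w = sumℚ (take (n ∸ 1) (reverse (sort (map (λ e → ∣ w e - ŵ e ∣) (allFin m)))))

  -- FtP run with precomputed tree T: the edges accepted, in the given arrival order
  ftpAccepted : Subset m → List (Fin m) → List (Fin m)
  ftpAccepted T order = filter (λ e → lookup T e Bool.≟ true) order

  ftpCost : (w : Fin m → ℚ) → Subset m → List (Fin m) → ℚ
  ftpCost w T order = sumℚ (map w (ftpAccepted T order))

module Submission where

-- FtP pays w(T) ≤ ŵ(T) + Σ_{e ∈ T} p_e ≤ ŵ(T*) + η ≤ w(T*) + 2η = Opt + 2η for an optimal
-- tree T*, because an acyclic edge set has at most n − 1 edges and therefore collects at most
-- the sum η of the n − 1 largest errors p_e. The edge bound comes from inserting the edges one by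
-- one into a union–find labelling of the vertices: an edge whose endpoints already carry the same
-- label would close a cycle, so every edge merges two classes and the number of classes (fixed
-- points of the labelling) drops by one each time.

open import Defs

open import Data.Bool using (true; false; if_then_else_)
import Data.Bool as Bool
open import Data.Nat as ℕ using (suc; _∸_; z≤n; s≤s)
import Data.Nat.Properties as ℕₚ
import Data.Integer as ℤ
open import Data.Rational
  using (ℚ; mkℚ; 0ℚ; 1ℚ; _+_; _-_; -_; _*_; _÷_; 1/_; ∣_∣; _≤_; NonZero; Positive)
open import Data.Rational.Properties
  using ( module ≤-Reasoning; ≤-refl; ≤-trans; ≤-reflexive; ≤-decTotalOrder
        ; +-mono-≤; +-monoʳ-≤; +-monoˡ-≤; +-identityˡ; +-identityʳ; +-0-isCommutativeMonoid
        ; *-inverseˡ; nonPositive⁻¹; 0≤∣p∣; ∣-p∣≡∣p∣)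
open import Data.Rational.Solver using (module +-*-Solver)
open import Data.Product using (∃-syntax; _×_; _,_; proj₁; proj₂)
open import Data.Sum using (_⊎_; inj₁; inj₂)
open import Data.Fin using (Fin)
open import Data.Fin.Properties using (_≟_)
open import Data.Fin.Subset as Subset using (Subset; _⊂_) renaming (_∈_ to _∈ₛ_)
open import Data.Fin.Subset.Properties using (x∈p⇒∣p-x∣<∣p∣; p⊂q⇒∣p∣<∣q∣; ∣p∣≤n)
open import Data.Vec using (lookup; tabulate)
open import Data.Vec.Properties using (lookup∘tabulate; lookup⇒[]=; []=⇒lookup)
open import Data.List using (List; []; _∷_; map; foldr; take; reverse; length; _++_; allFin)
open import Data.List.Properties using (unfold-reverse; length-map)
open import Data.List.Sort ≤-decTotalOrder using (sort; sort-↭; sort-↗)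
open import Data.List.Membership.Propositional using (_∈_; _∉_)
open import Data.List.Relation.Unary.Any using (here; there)
open import Data.List.Relation.Unary.All as All using (All; []; _∷_)
import Data.List.Relation.Unary.All.Properties as Allₚ
open import Data.List.Relation.Unary.All.Properties.Core using (¬Any⇒All¬)
open import Data.List.Relation.Unary.AllPairs as AllPairs using (AllPairs; []; _∷_)
import Data.List.Relation.Unary.AllPairs.Properties as AllPairsₚ
open import Data.List.Relation.Unary.Linked.Properties using (Linked⇒AllPairs)
open import Data.List.Relation.Unary.Unique.Propositional using (Unique)
open import Data.List.Relation.Unary.Unique.Propositional.Properties
  using (Unique[x∷xs]⇒x∉xs; filter⁺; allFin⁺)
open import Data.List.Relation.Binary.Permutation.Propositional
  using (_↭_; refl; prep; swap; trans; ↭-refl; ↭-sym; ↭⇒↭ₛ)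
import Data.List.Relation.Binary.Permutation.Propositional.Properties as ↭
open import Data.List.Relation.Binary.Permutation.Setoid.Properties using (foldr-commMonoid)
open import Data.List.Relation.Binary.Sublist.Propositional as Sublist using (_⊆_; []; _∷_; _∷ʳ_)
import Data.List.Relation.Binary.Sublist.Propositional.Properties as Sublistₚ
open import Data.List.Relation.Binary.Subset.Propositional using () renaming (_⊆_ to _⊆ₘ_)
open import Data.List.Relation.Binary.Subset.Propositional.Properties
  using (⊆-refl; ⊆-trans; xs⊆x∷xs; ∷⁺ʳ)
open import Function using (flip)
open import Relation.Nullary using (¬_; Dec; yes; no; contradiction)
open import Relation.Nullary.Decidable using (does; dec-true; dec-false)
open import Relation.Unary using (Decidable)
import Relation.Binary.PropositionalEquality as ≡
open import Relation.Binary.PropositionalEquality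
  using (_≡_; _≢_; refl; sym; cong; subst; setoid; module ≡-Reasoning)

-- Agrees definitionally with sumℚ G, so the lemmas below apply to cost, η and ftpCost.
sum : List ℚ → ℚ
sum = foldr _+_ 0ℚ

sum-↭ : ∀ {xs ys} → xs ↭ ys → sum xs ≡ sum ys
sum-↭ p = foldr-commMonoid (setoid ℚ) +-0-isCommutativeMonoid (↭⇒↭ₛ p)

sum-nonneg : ∀ {xs} → All (0ℚ ≤_) xs → 0ℚ ≤ sum xs
sum-nonneg []       = ≤-refl
sum-nonneg (p ∷ ps) = +-mono-≤ p (sum-nonneg ps)

sum-map-≤-+ : ∀ {A : Set} {f g h : A → ℚ} → (∀ x → f x ≤ g x + h x) →
              ∀ xs → sum (map f xs) ≤ sum (map g xs) + sum (map h xs)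
sum-map-≤-+ f≤g+h []       = ≤-refl
sum-map-≤-+ {g = g} {h} f≤g+h (x ∷ xs) = ≤-trans
  (+-mono-≤ (f≤g+h x) (sum-map-≤-+ f≤g+h xs))
  (≤-reflexive (interchange (g x) (h x) (sum (map g xs)) (sum (map h xs))))
  where
  open +-*-Solver
  interchange : ∀ a b c d → (a + b) + (c + d) ≡ (a + c) + (b + d)
  interchange = solve 4 (λ a b c d → (a :+ b) :+ (c :+ d) := (a :+ c) :+ (b :+ d)) refl

⊆-resp-↭ : ∀ {A : Set} {ys xs zs : List A} → ys ⊆ xs → xs ↭ zs →
           ∃[ ys′ ] (ys ↭ ys′ × ys′ ⊆ zs)
⊆-resp-↭ s                    refl         = _ , refl , s
⊆-resp-↭ (y ∷ʳ s)             (prep _ p)   with ⊆-resp-↭ s p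
... | ys′ , q , s′ = ys′ , q , y ∷ʳ s′
⊆-resp-↭ (refl ∷ s)           (prep _ p)   with ⊆-resp-↭ s p
... | ys′ , q , s′ = _ , prep _ q , refl ∷ s′
⊆-resp-↭ (x ∷ʳ (y ∷ʳ s))      (swap _ _ p) with ⊆-resp-↭ s p
... | ys′ , q , s′ = ys′ , q , y ∷ʳ (x ∷ʳ s′)
⊆-resp-↭ (x ∷ʳ (refl ∷ s))    (swap _ _ p) with ⊆-resp-↭ s p
... | ys′ , q , s′ = _ , prep _ q , refl ∷ (x ∷ʳ s′)
⊆-resp-↭ (refl ∷ (y ∷ʳ s))    (swap _ _ p) with ⊆-resp-↭ s p
... | ys′ , q , s′ = _ , prep _ q , y ∷ʳ (refl ∷ s′)
⊆-resp-↭ (refl ∷ (refl ∷ s))  (swap _ _ p) with ⊆-resp-↭ s p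
... | ys′ , q , s′ = _ , swap _ _ q , refl ∷ (refl ∷ s′)
⊆-resp-↭ s                    (trans p q)  with ⊆-resp-↭ s p
... | ys₁ , q₁ , s₁ with ⊆-resp-↭ s₁ q
... | ys₂ , q₂ , s₂ = ys₂ , trans q₁ q₂ , s₂

AllPairs-reverse⁺ : ∀ {A : Set} {R : A → A → Set} {xs} → AllPairs R xs → AllPairs (flip R) (reverse xs)
AllPairs-reverse⁺ []                       = []
AllPairs-reverse⁺ {R = R} {x ∷ xs} (r ∷ rs) = subst (AllPairs (flip R)) (sym (unfold-reverse x xs))
  (AllPairsₚ.++⁺ (AllPairs-reverse⁺ rs) ([] ∷ [])
    (All.map (_∷ []) (↭.All-resp-↭ (↭-sym (↭.↭-reverse xs)) r)))

Descending : List ℚ → Set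
Descending = AllPairs (flip _≤_)

sum-⊆-≤-sum-take : ∀ k {ys ds} → Descending ds → All (0ℚ ≤_) ds → ys ⊆ ds → length ys ℕ.≤ k →
                   sum ys ≤ sum (take k ds)
sum-⊆-≤-sum-take k       {[]}     _           nonneg       _          _         =
  sum-nonneg (Allₚ.take⁺ k nonneg)
sum-⊆-≤-sum-take (suc k) {y ∷ ys} (d≥ ∷ desc) (_ ∷ nonneg) (_ ∷ʳ s)   (s≤s len) =
  +-mono-≤ (All.lookup d≥ (Sublist.lookup s (here refl)))
           (sum-⊆-≤-sum-take k desc nonneg (Sublistₚ.∷ˡ⁻ s) len)
sum-⊆-≤-sum-take (suc k) {y ∷ ys} (_ ∷ desc)  (_ ∷ nonneg) (refl ∷ s) (s≤s len) =
  +-monoʳ-≤ y (sum-⊆-≤-sum-take k desc nonneg s len)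

sum-⊆-≤-sum-largest : ∀ k {ys xs} → All (0ℚ ≤_) xs → ys ⊆ xs → length ys ℕ.≤ k →
                      sum ys ≤ sum (take k (reverse (sort xs)))
sum-⊆-≤-sum-largest k {ys} {xs} nonneg ys⊆xs len = bound (⊆-resp-↭ ys⊆xs xs↭ds)
  where
  open ≤-Reasoning
  ds : List ℚ
  ds = reverse (sort xs)
  xs↭ds : xs ↭ ds
  xs↭ds = trans (↭-sym (sort-↭ xs)) (↭-sym (↭.↭-reverse (sort xs)))
  descending : Descending ds
  descending = AllPairs-reverse⁺ (Linked⇒AllPairs ≤-trans (sort-↗ xs))
  bound : ∃[ ys′ ] (ys ↭ ys′ × ys′ ⊆ ds) → sum ys ≤ sum (take k ds)
  bound (ys′ , ys↭ys′ , ys′⊆ds) = begin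
    sum ys            ≡⟨ sum-↭ ys↭ys′ ⟩
    sum ys′           ≤⟨ sum-⊆-≤-sum-take k descending (↭.All-resp-↭ xs↭ds nonneg) ys′⊆ds
                           (subst (ℕ._≤ k) (↭.↭-length ys↭ys′) len) ⟩
    sum (take k ds)   ∎

p≤∣p∣ : ∀ p → p ≤ ∣ p ∣
p≤∣p∣ (mkℚ (ℤ.+ _)      _ _) = ≤-refl
p≤∣p∣ p@(mkℚ ℤ.-[1+ _ ] _ _) = ≤-trans (nonPositive⁻¹ p) (0≤∣p∣ p)

p≤q+∣p-q∣ : ∀ p q → p ≤ q + ∣ p - q ∣
p≤q+∣p-q∣ p q = begin
  p              ≡⟨ solve 2 (λ p q → p := q :+ (p :- q)) refl p q ⟩
  q + (p - q)    ≤⟨ +-monoʳ-≤ q (p≤∣p∣ (p - q)) ⟩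
  q + ∣ p - q ∣  ∎
  where open ≤-Reasoning; open +-*-Solver

q≤p+∣p-q∣ : ∀ p q → q ≤ p + ∣ p - q ∣
q≤p+∣p-q∣ p q = begin
  q                  ≤⟨ p≤q+∣p-q∣ q p ⟩
  p + ∣ q - p ∣     ≡⟨ cong (λ r → p + ∣ r ∣) (solve 2 (λ p q → q :- p := :- (p :- q)) refl p q) ⟩
  p + ∣ - (p - q) ∣  ≡⟨ cong (p +_) (∣-p∣≡∣p∣ (p - q)) ⟩
  p + ∣ p - q ∣      ∎
  where open ≤-Reasoning; open +-*-Solver

[p+q]+q≡[1+2[q÷p]]*p : ∀ p q .{{_ : NonZero p}} → (p + q) + q ≡ (1ℚ + (1ℚ + 1ℚ) * (q ÷ p)) * p
[p+q]+q≡[1+2[q÷p]]*p p q = begin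
  (p + q) + q
    ≡⟨ solve 2 (λ p q → (p :+ q) :+ q := p :+ (con 1ℚ :+ con 1ℚ) :* q :* con 1ℚ) refl p q ⟩
  p + (1ℚ + 1ℚ) * q * 1ℚ
    ≡⟨ cong (λ r → p + (1ℚ + 1ℚ) * q * r) (sym (*-inverseˡ p)) ⟩
  p + (1ℚ + 1ℚ) * q * (1/ p * p)
    ≡⟨ solve 3 (λ p q i → p :+ (con 1ℚ :+ con 1ℚ) :* q :* (i :* p)
                       := (con 1ℚ :+ (con 1ℚ :+ con 1ℚ) :* (q :* i)) :* p) refl p q (1/ p) ⟩
  (1ℚ + (1ℚ + 1ℚ) * (q ÷ p)) * p
    ∎
  where open ≡-Reasoning; open +-*-Solver

module _ (G : Graph) where
  open Graph G
  open import Data.List.Membership.DecPropositional (_≟_ {m}) using (_∈?_)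

  walk-++ : ∀ {S x y z as bs} → Walk G S x y as → Walk G S y z bs → Walk G S x z (as ++ bs)
  walk-++ nil            w′ = w′
  walk-++ (step Se j w)  w′ = step Se j (walk-++ w w′)

  joins-endpoint : ∀ {e u v a b} → Joins G e u v → Joins G e a b → b ≡ u ⊎ b ≡ v
  joins-endpoint (inj₁ p) (inj₁ q) = inj₂ (cong proj₂ (≡.trans (sym q) p))
  joins-endpoint (inj₁ p) (inj₂ q) = inj₁ (cong proj₁ (≡.trans (sym q) p))
  joins-endpoint (inj₂ p) (inj₁ q) = inj₁ (cong proj₂ (≡.trans (sym q) p))
  joins-endpoint (inj₂ p) (inj₂ q) = inj₂ (cong proj₁ (≡.trans (sym q) p))

  TrailWithin : Subset m → Fin n → Fin n → List (Fin m) → Set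
  TrailWithin S x y es = ∃[ ts ] (Walk G S x y ts × Unique ts × ts ⊆ₘ es)

  trailWithin-⊆ : ∀ {S x y es fs} → es ⊆ₘ fs → TrailWithin S x y es → TrailWithin S x y fs
  trailWithin-⊆ es⊆fs (ts , t , uniq , ts⊆es) = ts , t , uniq , ⊆-trans ts⊆es es⊆fs

  trail-after : ∀ {S x y e es} → Walk G S x y es → Unique es → e ∈ es →
                ∃[ a ] ∃[ b ] ∃[ bs ]
                  (Joins G e a b × Walk G S b y bs × Unique (e ∷ bs) × bs ⊆ₘ es)
  trail-after (step _ j w) uniq       (here refl)  = _ , _ , _ , j , w , uniq , xs⊆x∷xs _ _
  trail-after (step _ _ w) (_ ∷ uniq) (there e∈es) with trail-after w uniq e∈es
  ... | a , b , bs , j , w′ , uniq′ , bs⊆es =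
    a , b , bs , j , w′ , uniq′ , ⊆-trans bs⊆es (xs⊆x∷xs _ _)

  -- After stepping from u along e, a trail that uses e again can be cut to what follows that use:
  -- it restarts at u (drop e) or at the other endpoint (keep e).

  reroute : ∀ {S e u v a b y bs} → lookup S e ≡ true → Joins G e u v → Joins G e a b →
            Walk G S b y bs → Unique (e ∷ bs) → TrailWithin S u y (e ∷ bs)
  reroute {e = e} {bs = bs} Se j j′ t uniq with joins-endpoint j j′
  ... | inj₁ refl = bs , t , AllPairs.tail uniq , xs⊆x∷xs bs e
  ... | inj₂ refl = e ∷ bs , step Se j t , uniq , ⊆-refl

  trail-step : ∀ {S e u v y es} → lookup S e ≡ true → Joins G e u v →
               TrailWithin S v y es → TrailWithin S u y (e ∷ es)
  trail-step {e = e} Se j (ts , t , uniq , ts⊆es) with e ∈? ts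
  ... | no e∉ts  = e ∷ ts , step Se j t , ¬Any⇒All¬ ts e∉ts ∷ uniq , ∷⁺ʳ e ts⊆es
  ... | yes e∈ts with trail-after t uniq e∈ts
  ...   | _ , _ , bs , j′ , t′ , uniq′ , bs⊆ts =
    trailWithin-⊆ (∷⁺ʳ e (⊆-trans bs⊆ts ts⊆es)) (reroute Se j j′ t′ uniq′)

  walk⇒trail : ∀ {S x y es} → Walk G S x y es → TrailWithin S x y es
  walk⇒trail nil           = [] , nil , [] , (λ ())
  walk⇒trail (step Se j w) = trail-step Se j (walk⇒trail w)

fixedPoints : ∀ {n} → (Fin n → Fin n) → Subset n
fixedPoints f = tabulate (λ x → does (f x ≟ x))

∈-fixedPoints⁺ : ∀ {n} (f : Fin n → Fin n) {x} → f x ≡ x → x ∈ₛ fixedPoints f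
∈-fixedPoints⁺ f {x} fx≡x =
  lookup⇒[]= x _ (≡.trans (lookup∘tabulate _ x) (dec-true (f x ≟ x) fx≡x))

∈-fixedPoints⁻ : ∀ {n} (f : Fin n → Fin n) {x} → x ∈ₛ fixedPoints f → f x ≡ x
∈-fixedPoints⁻ f {x} x∈ with f x ≟ x | ≡.trans (sym (lookup∘tabulate _ x)) ([]=⇒lookup x∈)
... | yes fx≡x | _ = fx≡x
... | no _     | ()

fixedPoints-nonempty : ∀ {n} (f : Fin n → Fin n) {x} → f x ≡ x → 0 ℕ.< Subset.∣ fixedPoints f ∣
fixedPoints-nonempty f fx≡x = ℕₚ.≤-<-trans z≤n (x∈p⇒∣p-x∣<∣p∣ (∈-fixedPoints⁺ f fx≡x))

module _ (G : Graph) (S : Subset (Graph.m G)) where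
  open Graph G

  -- lab sends every vertex to a representative of its class; vertices in one class are joined
  -- by walks avoiding the edges rs that are still to be inserted.
  record ComponentLabelling (rs : List (Fin m)) (lab : Fin n → Fin n) : Set where
    field
      idempotent : ∀ x → lab (lab x) ≡ lab x
      linked     : ∀ {x y} → lab x ≡ lab y → ∃[ es ] (Walk G S x y es × All (_∉ rs) es)

  identityLabelling : ∀ rs → ComponentLabelling rs (λ x → x)
  identityLabelling rs = record { idempotent = λ _ → refl ; linked = λ { refl → [] , nil , [] } }

  module Insert {e rs lab} (L : ComponentLabelling (e ∷ rs) lab)
                (Se : lookup S e ≡ true) (e∉rs : e ∉ rs) where
    open ComponentLabelling L

    u v : Fin n
    u = proj₁ (ends e)
    v = proj₂ (ends e)

    closes-cycle : lab u ≡ lab v → HasCycle G S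
    closes-cycle u∼v with linked u∼v
    ... | es , w , avoid with walk⇒trail G w
    ...   | ts , t , uniq , ts⊆es =
      v , e ∷ ts , step Se (inj₂ refl) t , (λ ()) , All.map e∉ (Allₚ.anti-mono ts⊆es avoid) ∷ uniq
      where
      e∉ : ∀ {f} → f ∉ e ∷ rs → e ≢ f
      e∉ f∉ e≡f = f∉ (here (sym e≡f))

    linked-rs : ∀ {x y} → lab x ≡ lab y → ∃[ es ] (Walk G S x y es × All (_∉ rs) es)
    linked-rs x∼y with linked x∼y
    ... | es , w , avoid = es , w , All.map (λ f∉ f∈ → f∉ (there f∈)) avoid

    bridge : ∀ {x a b y} → Joins G e a b → lab x ≡ lab a → lab b ≡ lab y →
             ∃[ es ] (Walk G S x y es × All (_∉ rs) es)
    bridge j x∼a b∼y with linked-rs x∼a | linked-rs b∼y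
    ... | es₁ , w₁ , avoid₁ | es₂ , w₂ , avoid₂ =
      es₁ ++ e ∷ es₂ , walk-++ G w₁ (step Se j w₂) , Allₚ.++⁺ avoid₁ (e∉rs ∷ avoid₂)

    relabel : Fin n → Fin n
    relabel x = if does (lab x ≟ lab v) then lab u else lab x

    relabel-∼v : ∀ {x} → lab x ≡ lab v → relabel x ≡ lab u
    relabel-∼v {x} x∼v rewrite dec-true (lab x ≟ lab v) x∼v = refl

    relabel-≁v : ∀ {x} → lab x ≢ lab v → relabel x ≡ lab x
    relabel-≁v {x} x≁v rewrite dec-false (lab x ≟ lab v) x≁v = refl

    module _ (u≁v : lab u ≢ lab v) where

      relabel-fixes : ∀ {x} → lab x ≢ lab v → relabel (lab x) ≡ lab x
      relabel-fixes {x} x≁v =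
        ≡.trans (relabel-≁v (subst (_≢ lab v) (sym (idempotent x)) x≁v)) (idempotent x)

      relabel-idempotent : ∀ x → relabel (relabel x) ≡ relabel x
      relabel-idempotent x = cases (lab x ≟ lab v)
        where
        cases : Dec (lab x ≡ lab v) → relabel (relabel x) ≡ relabel x
        cases (yes x∼v) = begin
          relabel (relabel x)  ≡⟨ cong relabel (relabel-∼v x∼v) ⟩
          relabel (lab u)      ≡⟨ relabel-fixes u≁v ⟩
          lab u                ≡⟨ sym (relabel-∼v x∼v) ⟩
          relabel x            ∎
          where open ≡-Reasoning
        cases (no x≁v) = begin
          relabel (relabel x)  ≡⟨ cong relabel (relabel-≁v x≁v) ⟩
          relabel (lab x)      ≡⟨ relabel-fixes x≁v ⟩
          lab x                ≡⟨ sym (relabel-≁v x≁v) ⟩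
          relabel x            ∎
          where open ≡-Reasoning

      relabel-linked : ∀ {x y} → relabel x ≡ relabel y → ∃[ es ] (Walk G S x y es × All (_∉ rs) es)
      relabel-linked {x} {y} x≈y = cases (lab x ≟ lab v) (lab y ≟ lab v)
        where
        cases : Dec (lab x ≡ lab v) → Dec (lab y ≡ lab v) → ∃[ es ] (Walk G S x y es × All (_∉ rs) es)
        cases (yes x∼v) (yes y∼v) = linked-rs (≡.trans x∼v (sym y∼v))
        cases (no  x≁v) (no  y≁v) = linked-rs
          (≡.trans (sym (relabel-≁v x≁v)) (≡.trans x≈y (relabel-≁v y≁v)))
        cases (yes x∼v) (no  y≁v) = bridge (inj₂ refl) x∼v
          (≡.trans (sym (relabel-∼v x∼v)) (≡.trans x≈y (relabel-≁v y≁v)))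
        cases (no  x≁v) (yes y∼v) = bridge (inj₁ refl)
          (≡.trans (sym (relabel-≁v x≁v)) (≡.trans x≈y (relabel-∼v y∼v))) (sym y∼v)

      relabelling : ComponentLabelling rs relabel
      relabelling = record { idempotent = relabel-idempotent ; linked = relabel-linked }

      relabel-fixed⇒fixed : ∀ {x} → relabel x ≡ x → lab x ≡ x
      relabel-fixed⇒fixed {x} rx≡x = cases (lab x ≟ lab v)
        where
        cases : Dec (lab x ≡ lab v) → lab x ≡ x
        cases (yes x∼v) = begin
          lab x          ≡⟨ cong lab x≡u ⟩
          lab (lab u)    ≡⟨ idempotent u ⟩
          lab u          ≡⟨ sym x≡u ⟩
          x              ∎
          where
          open ≡-Reasoning
          x≡u : x ≡ lab u
          x≡u = ≡.trans (sym rx≡x) (relabel-∼v x∼v)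
        cases (no x≁v) = ≡.trans (sym (relabel-≁v x≁v)) rx≡x

      fixedPoints-relabel⊂ : fixedPoints relabel ⊂ fixedPoints lab
      fixedPoints-relabel⊂ =
        (λ x∈ → ∈-fixedPoints⁺ lab (relabel-fixed⇒fixed (∈-fixedPoints⁻ relabel x∈))) ,
        lab v , ∈-fixedPoints⁺ lab (idempotent v) ,
        λ v∈ → u≁v (≡.trans (sym (relabel-∼v (idempotent v))) (∈-fixedPoints⁻ relabel v∈))

  length<∣fixedPoints∣ : ¬ HasCycle G S → Fin n → ∀ {rs lab} → ComponentLabelling rs lab →
                         Unique rs → All (λ e → lookup S e ≡ true) rs →
                         length rs ℕ.< Subset.∣ fixedPoints lab ∣
  length<∣fixedPoints∣ _       z {[]} {lab}       L _    _          =
    fixedPoints-nonempty lab (ComponentLabelling.idempotent L z)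
  length<∣fixedPoints∣ acyclic z {e ∷ rs} {lab} L uniq (Se ∷ inS) = cases (lab u ≟ lab v)
    where
    open Insert L Se (Unique[x∷xs]⇒x∉xs uniq)
    cases : Dec (lab u ≡ lab v) → length (e ∷ rs) ℕ.< Subset.∣ fixedPoints lab ∣
    cases (yes u∼v) = contradiction (closes-cycle u∼v) acyclic
    cases (no  u≁v) = ℕₚ.≤-trans
      (s≤s (length<∣fixedPoints∣ acyclic z (relabelling u≁v) (AllPairs.tail uniq) inS))
      (p⊂q⇒∣p∣<∣q∣ (fixedPoints-relabel⊂ u≁v))

  acyclic⇒length≤n∸1 : ¬ HasCycle G S → ∀ {es} → Unique es → All (λ e → lookup S e ≡ true) es →
                       length es ℕ.≤ n ∸ 1
  acyclic⇒length≤n∸1 _       {[]}      _    _   = z≤n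
  acyclic⇒length≤n∸1 acyclic {e ∷ es} uniq inS = ℕₚ.∸-monoˡ-≤ {n = n} 1 (ℕₚ.<-≤-trans
    (length<∣fixedPoints∣ acyclic (proj₁ (ends e)) (identityLabelling (e ∷ es)) uniq inS)
    (∣p∣≤n (fixedPoints (λ x → x))))

module _ (G : Graph) where
  open Graph G

  ftpCost-masked : ∀ c S xs → ftpCost G c S xs ≡ sum (map (λ e → if lookup S e then c e else 0ℚ) xs)
  ftpCost-masked c S []       = refl
  ftpCost-masked c S (x ∷ xs) with lookup S x
  ... | true  = cong (c x +_) (ftpCost-masked c S xs)
  ... | false = ≡.trans (ftpCost-masked c S xs) (sym (+-identityˡ _))

  ftpCost≡cost : ∀ c S {order} → order ↭ allFin m → ftpCost G c S order ≡ cost G c S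
  ftpCost≡cost c S {order} order↭ = ≡.trans (ftpCost-masked c S order) (sum-↭ (↭.map⁺ _ order↭))

  cost-≤-+ : ∀ {f g h} S → (∀ e → f e ≤ g e + h e) → cost G f S ≤ cost G g S + cost G h S
  cost-≤-+ {f} {g} {h} S f≤g+h = sum-map-≤-+ masked-≤ (allFin m)
    where
    masked-≤ : ∀ e → (if lookup S e then f e else 0ℚ) ≤
                     (if lookup S e then g e else 0ℚ) + (if lookup S e then h e else 0ℚ)
    masked-≤ e with lookup S e
    ... | true  = f≤g+h e
    ... | false = ≤-reflexive (sym (+-identityʳ 0ℚ))

  cost-≤-η : ∀ ŵ w S → ¬ HasCycle G S → cost G (λ e → ∣ w e - ŵ e ∣) S ≤ η G ŵ w
  cost-≤-η ŵ w S acyclic = begin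
    cost G err S         ≡⟨ sym (ftpCost≡cost err S ↭-refl) ⟩
    sum (map err edges)  ≤⟨ sum-⊆-≤-sum-largest (n ∸ 1) nonneg (Sublistₚ.map⁺ err edges⊆) len ⟩
    η G ŵ w              ∎
    where
    open ≤-Reasoning
    err : Fin m → ℚ
    err e = ∣ w e - ŵ e ∣
    inS? : Decidable (λ e → lookup S e ≡ true)
    inS? e = lookup S e Bool.≟ true
    edges : List (Fin m)
    edges = ftpAccepted G S (allFin m)
    edges⊆ : edges ⊆ allFin m
    edges⊆ = Sublistₚ.filter-⊆ inS? (allFin m)
    nonneg : All (0ℚ ≤_) (map err (allFin m))
    nonneg = Allₚ.map⁺ (All.universal (λ e → 0≤∣p∣ (w e - ŵ e)) (allFin m))
    len : length (map err edges) ℕ.≤ n ∸ 1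
    len = subst (ℕ._≤ n ∸ 1) (sym (length-map err edges))
      (acyclic⇒length≤n∸1 G S acyclic (filter⁺ inS? (allFin⁺ m)) (Allₚ.all-filter inS? (allFin m)))

mainTheorem3 : (G : Graph) → Simple G → Connected G
    → (ŵ w : Fin (Graph.m G) → ℚ)
    → (∀ e → Positive (ŵ e)) → (∀ e → Positive (w e))
    → (order : List (Fin (Graph.m G))) → order ↭ allFin (Graph.m G)
    → (T : Subset (Graph.m G)) → IsMST G ŵ T
    → (opt : ℚ) → IsOpt G w opt → .{{_ : NonZero opt}}
    → ftpCost G w T order ≤ (1ℚ + (1ℚ + 1ℚ) * (η G ŵ w ÷ opt)) * opt
mainTheorem3 G _ _ ŵ w _ _ order order↭ T ((_ , T-acyclic) , T-minimal) opt
             ((T* , T*-tree@(_ , T*-acyclic) , T*-optimal) , _) = begin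
  ftpCost G w T order
    ≡⟨ ftpCost≡cost G w T order↭ ⟩
  cost G w T
    ≤⟨ cost-≤-+ G T (λ e → p≤q+∣p-q∣ (w e) (ŵ e)) ⟩
  cost G ŵ T + cost G err T
    ≤⟨ +-mono-≤ (T-minimal T* T*-tree) (cost-≤-η G ŵ w T T-acyclic) ⟩
  cost G ŵ T* + η G ŵ w
    ≤⟨ +-monoˡ-≤ (η G ŵ w) (cost-≤-+ G T* (λ e → q≤p+∣p-q∣ (w e) (ŵ e))) ⟩
  (cost G w T* + cost G err T*) + η G ŵ w
    ≤⟨ +-monoˡ-≤ (η G ŵ w) (+-mono-≤ (≤-reflexive T*-optimal) (cost-≤-η G ŵ w T* T*-acyclic)) ⟩
  (opt + η G ŵ w) + η G ŵ w
    ≡⟨ [p+q]+q≡[1+2[q÷p]]*p opt (η G ŵ w) ⟩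
  (1ℚ + (1ℚ + 1ℚ) * (η G ŵ w ÷ opt)) * opt
    ∎
  where
  open ≤-Reasoning
  err : Fin (Graph.m G) → ℚ
  err e = ∣ w e - ŵ e ∣
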